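{- Let $T$ be an increasing tree with $k$ edges. Then ${\rm ex}_{\rightarrow}(n,T)=(k-1)n-\binom{k}{2}$ for all $n\ge k+1$.
   Context: An ordered graph is a graph with a linearly ordered vertex set; an $n$-vertex ordered graph has vertex set $[n]$ with the natural order. An ordered graph $F$ is contained in an ordered graph $G$ if there is an injective order-preserving map $V(F)\to V(G)$ mapping edges to edges. ${\rm ex}_{\rightarrow}(n,F)$ is the maximum number of edges in an $n$-vertex ordered graph not containing $F$. The length of an edge $ij$ is $|i-j|$. An increasing tree is an ordered tree defined recursively: a single edge is an increasing tree; given an increasing tree whose vertices are split into intervals $I<J$ (all edges go between $I$ and $J$) with longest edge $ij$, $i\in I$, $j\in J$ (here $i$ is the first and $j$ the last vertex of the tree), one obtains an increasing tree with one more edge by adding a new vertex $j'>j$ to $J$ together with the edge $ij'$, or a new vertex $i'<i$ to $I$ together with the edge $i'j$. -}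

module Defs where

open import Data.Nat using (ℕ; zero; suc; _+_; _*_; _∸_; _≤_; _<_; _≡ᵇ_; _<ᵇ_)
open import Data.Nat.Combinatorics using (_C_)
open import Data.Bool using (Bool; true; false; _∧_; if_then_else_)
open import Data.Fin using (Fin; toℕ)
open import Data.List using (List; map; concatMap; allFin)
open import Data.Nat.ListAction using (sum)
open import Data.Product using (Σ; ∃; _×_)
open import Relation.Nullary using (¬_)
open import Relation.Binary.PropositionalEquality using (_≡_)

-- An ordered graph on [n] = {0,...,n-1} with its natural order.
-- For i < j, the pair {i,j} is an edge iff  adj i j ≡ true.
-- Values of adj on pairs with i ≥ j are ignored (simple undirected graph,
-- each edge recorded once with endpoints in increasing order).
OrdGraph : ℕ → Set
OrdGraph n = Fin n → Fin n → Bool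

boolToℕ : Bool → ℕ
boolToℕ true  = 1
boolToℕ false = 0

edgeCount : ∀ {n} → OrdGraph n → ℕ
edgeCount {n} G =
  sum (concatMap (λ i → map (λ j → boolToℕ ((toℕ i <ᵇ toℕ j) ∧ G i j)) (allFin n)) (allFin n))

Contains : ∀ {m n} → OrdGraph m → OrdGraph n → Set
Contains {m} {n} F G =
  Σ (Fin m → Fin n) λ f →
    (∀ i j → toℕ i < toℕ j → toℕ (f i) < toℕ (f j)) ×
    (∀ i j → toℕ i < toℕ j → F i j ≡ true → G (f i) (f j) ≡ true)

IsOrdEx : ∀ {m} → ℕ → OrdGraph m → ℕ → Set
IsOrdEx n F e =
  (Σ (OrdGraph n) λ G → ¬ Contains F G × edgeCount G ≡ e) ×
  (∀ (G : OrdGraph n) → ¬ Contains F G → edgeCount G ≤ e)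

-- Increasing trees with k edges, via their recursive construction.
-- A tree with k edges has k+1 vertices 0..k; its first vertex is 0
-- and its last vertex is k.
data IncTree : ℕ → Set where
  single   : IncTree 1
  -- new vertex j' after the last vertex j, with edge i j' (i = first vertex)
  addRight : ∀ {k} → IncTree k → IncTree (suc k)
  -- new vertex i' before the first vertex i, with edge i' j (j = last vertex)
  addLeft  : ∀ {k} → IncTree k → IncTree (suc k)

-- adjacency on ℕ-labelled vertices (only pairs a < b ≤ k are meaningful)
treeAdj : ∀ {k} → IncTree k → ℕ → ℕ → Bool
treeAdj single a b = (a ≡ᵇ 0) ∧ (b ≡ᵇ 1)
treeAdj {suc k} (addRight t) a b =
  if b ≡ᵇ suc k then (a ≡ᵇ 0) else treeAdj t a b
treeAdj {suc k} (addLeft t) zero b = b ≡ᵇ suc k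
treeAdj {suc k} (addLeft t) (suc a) b = treeAdj t a (b ∸ 1)

treeGraph : ∀ {k} → IncTree k → OrdGraph (suc k)
treeGraph t i j = treeAdj t (toℕ i) (toℕ j)

module Submission where

-- Write B k n = (k ∸ 1) * n ∸ k C 2; it satisfies B 1 n = 0 and
-- B (k + 1) n = B k n + (n ∸ k) for 1 ≤ k < n (B-step).  Let T be an
-- increasing tree with k edges, on vertices 0 … k, with longest edge 0—k.
--
-- Lower bound: an increasing map stretches 0—k to length ≥ k (stretch), so
-- the band graph of all pairs at distance < k avoids T; counting its pairs
-- one distance d at a time (n ∸ d of them) gives B k n edges.
--
-- Upper bound, by induction along the construction of T, for the predicate
-- Hosts G T u w ("G has a copy of T from u to w", built like T), whose
-- copies are genuine embeddings (hosts⇒copy).  If G has no copy of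
-- addRight T, delete at each vertex i with i + k < n its last edge to the
-- right: at most n ∸ k edges go, and no copy of T survives, since its edge
-- u—w (with w ≥ u + k) was kept only because some later edge u—x of G
-- extends the copy.  addLeft T is symmetric, with first edges from the left.

open import Defs
open import Data.Nat using (ℕ; suc; _+_; _*_; _∸_; _≤_)
open import Data.Nat.Combinatorics using (_C_)
open import Data.Nat using (zero; _<_; _⊓_; z≤n; s≤s; z<s; _<ᵇ_; _≡ᵇ_)
open import Data.Nat.Properties
open import Data.Nat.Combinatorics using (nC1≡n; nCk+nC[k+1]≡[n+1]C[k+1])
open import Data.Nat.ListAction using (sum)
open import Data.Nat.ListAction.Properties using (sum-++)
open import Algebra.Properties.CommutativeMonoid.Sum +-0-commutativeMonoid
  using (sum-syntax; sum-cong-≗; sum-replicate-zero; ∑-distrib-+; ∑-comm)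
open import Data.Bool using (Bool; true; false; _∧_; _∨_; T)
open import Data.Bool.Properties using (∧-assoc; ∧-identityʳ; ∧-zeroʳ; T-≡)
open import Data.Fin using (Fin; zero; suc; toℕ; fromℕ; inject₁)
open import Data.Fin.Properties using (toℕ-injective; toℕ<n; toℕ-fromℕ; toℕ-inject₁; ≤fromℕ)
open import Data.Fin.Relation.Unary.Top using (view; ‵fromℕ; ‵inj₁; view-fromℕ)
open import Data.List using (List; map; concatMap; allFin; tabulate)
open import Data.Vec.Functional using (_∷_; [])
open import Data.Product using (∃; _×_; _,_)
open import Data.Sum using (inj₁; inj₂)
open import Data.Empty using (⊥-elim)
open import Relation.Nullary using (¬_)
open import Relation.Binary.PropositionalEquality
open import Function using (_∘_; id; Equivalence)

≡true⇒T : ∀ {b} → b ≡ true → T b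
≡true⇒T = Equivalence.from T-≡

T⇒≡true : ∀ {b} → T b → b ≡ true
T⇒≡true = Equivalence.to T-≡

∧-trueˡ : ∀ {a b} → (a ∧ b) ≡ true → a ≡ true
∧-trueˡ {true} _ = refl

∧-trueʳ : ∀ {a b} → (a ∧ b) ≡ true → b ≡ true
∧-trueʳ {true} e = e

∧-true : ∀ {a b} → a ≡ true → b ≡ true → (a ∧ b) ≡ true
∧-true refl e = e

<ᵇ-sound : ∀ {a b} → (a <ᵇ b) ≡ true → a < b
<ᵇ-sound {a} {b} e = <ᵇ⇒< a b (≡true⇒T e)

<ᵇ-complete : ∀ {a b} → a < b → (a <ᵇ b) ≡ true
<ᵇ-complete a<b = T⇒≡true (<⇒<ᵇ a<b)

≡ᵇ-sound : ∀ {a b} → (a ≡ᵇ b) ≡ true → a ≡ b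
≡ᵇ-sound {a} {b} e = ≡ᵇ⇒≡ a b (≡true⇒T e)

≡ᵇ-refl : ∀ a → (a ≡ᵇ a) ≡ true
≡ᵇ-refl a = T⇒≡true (≡⇒≡ᵇ a a refl)

_⇒ᵇ_ : Bool → Bool → Bool
true  ⇒ᵇ b = b
false ⇒ᵇ b = true

⇒ᵇ-mp : ∀ {c b} → c ≡ true → (c ⇒ᵇ b) ≡ true → b ≡ true
⇒ᵇ-mp refl e = e

∑-mono-≤ : ∀ {n} {f g : Fin n → ℕ} → (∀ i → f i ≤ g i) → ∑[ i < n ] f i ≤ ∑[ i < n ] g i
∑-mono-≤ {zero}  _   = z≤n
∑-mono-≤ {suc n} f≤g = +-mono-≤ (f≤g zero) (∑-mono-≤ (f≤g ∘ suc))

∑-zero : ∀ {n} {f : Fin n → ℕ} → (∀ i → f i ≡ 0) → ∑[ i < n ] f i ≡ 0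
∑-zero {n} f≡0 = trans (sum-cong-≗ f≡0) (sum-replicate-zero n)

sum-map-tabulate : ∀ {n} {A : Set} (f : Fin n → A) (g : A → ℕ) →
  sum (map g (tabulate f)) ≡ ∑[ i < n ] g (f i)
sum-map-tabulate {zero}  f g = refl
sum-map-tabulate {suc n} f g = cong (g (f zero) +_) (sum-map-tabulate (f ∘ suc) g)

sum-concatMap-tabulate : ∀ {n} {A : Set} (f : Fin n → A) (g : A → List ℕ) →
  sum (concatMap g (tabulate f)) ≡ ∑[ i < n ] sum (g (f i))
sum-concatMap-tabulate {zero}  f g = refl
sum-concatMap-tabulate {suc n} f g =
  trans (sum-++ (g (f zero)) _) (cong (sum (g (f zero)) +_) (sum-concatMap-tabulate (f ∘ suc) g))

edge? : ∀ {n} → OrdGraph n → Fin n → Fin n → Bool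
edge? G u w = (toℕ u <ᵇ toℕ w) ∧ G u w

Edge : ∀ {n} → OrdGraph n → Fin n → Fin n → Set
Edge G u w = edge? G u w ≡ true

edges : ∀ {n} → OrdGraph n → ℕ
edges {n} G = ∑[ i < n ] ∑[ j < n ] boolToℕ (edge? G i j)

edgeCount≡edges : ∀ {n} (G : OrdGraph n) → edgeCount G ≡ edges G
edgeCount≡edges {n} G =
  trans (sum-concatMap-tabulate id row)
        (sum-cong-≗ (λ i → sum-map-tabulate id (λ j → boolToℕ (edge? G i j))))
  where
  row : Fin n → List ℕ
  row i = map (λ j → boolToℕ (edge? G i j)) (allFin n)

rowwise-≤ : ∀ {n} (G G' : OrdGraph n) (d : Fin n → ℕ) →
  (∀ i → ∑[ j < n ] boolToℕ (edge? G i j) ≤ ∑[ j < n ] boolToℕ (edge? G' i j) + d i) →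
  edges G ≤ edges G' + ∑[ i < n ] d i
rowwise-≤ {n} G G' d loss = begin
  edges G                                                           ≤⟨ ∑-mono-≤ loss ⟩
  ∑[ i < n ] (∑[ j < n ] boolToℕ (edge? G' i j) + d i)              ≡⟨ ∑-distrib-+ _ d ⟩
  edges G' + ∑[ i < n ] d i                                         ∎
  where open ≤-Reasoning

colwise-≤ : ∀ {n} (G G' : OrdGraph n) (d : Fin n → ℕ) →
  (∀ j → ∑[ i < n ] boolToℕ (edge? G i j) ≤ ∑[ i < n ] boolToℕ (edge? G' i j) + d j) →
  edges G ≤ edges G' + ∑[ j < n ] d j
colwise-≤ {n} G G' d loss = begin
  edges G                                                 ≡⟨ ∑-comm (λ i j → boolToℕ (edge? G i j)) ⟩
  ∑[ j < n ] ∑[ i < n ] boolToℕ (edge? G i j)             ≤⟨ ∑-mono-≤ loss ⟩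
  ∑[ j < n ] (∑[ i < n ] boolToℕ (edge? G' i j) + d j)    ≡⟨ ∑-distrib-+ _ d ⟩
  ∑[ j < n ] ∑[ i < n ] boolToℕ (edge? G' i j) + ∑[ j < n ] d j
    ≡⟨ cong (_+ ∑[ j < n ] d j) (∑-comm (λ j i → boolToℕ (edge? G' i j))) ⟩
  edges G' + ∑[ j < n ] d j                               ∎
  where open ≤-Reasoning

count-below : ∀ m c → ∑[ i < m ] boolToℕ (toℕ i <ᵇ c) ≡ m ⊓ c
count-below zero    c       = refl
count-below (suc m) zero    = ∑-zero {m} (λ _ → refl)
count-below (suc m) (suc c) = cong suc (count-below m c)

+-<ᵇ-∸ : ∀ k a n → (k + a <ᵇ n) ≡ (a <ᵇ n ∸ k)
+-<ᵇ-∸ zero    a n       = refl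
+-<ᵇ-∸ (suc k) a zero    = refl
+-<ᵇ-∸ (suc k) a (suc n) = +-<ᵇ-∸ k a n

count-rows : ∀ n k → ∑[ i < n ] boolToℕ (k + toℕ i <ᵇ n) ≡ n ∸ k
count-rows n k = begin
  ∑[ i < n ] boolToℕ (k + toℕ i <ᵇ n)  ≡⟨ sum-cong-≗ {n} (λ i → cong boolToℕ (+-<ᵇ-∸ k (toℕ i) n)) ⟩
  ∑[ i < n ] boolToℕ (toℕ i <ᵇ n ∸ k)  ≡⟨ count-below n (n ∸ k) ⟩
  n ⊓ (n ∸ k)                          ≡⟨ m≥n⇒m⊓n≡n (m∸n≤m n k) ⟩
  n ∸ k                                ∎
  where open ≡-Reasoning

-- The vertices j ≥ k (written k < suc j, which computes well).
count-cols : ∀ n k → ∑[ j < n ] boolToℕ (k <ᵇ suc (toℕ j)) ≡ n ∸ k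
count-cols zero    k       = sym (0∸n≡0 k)
count-cols (suc n) zero    = cong suc (count-cols n zero)
count-cols (suc n) (suc k) = count-cols n k

count-eq : ∀ n m → ∑[ j < n ] boolToℕ (toℕ j ≡ᵇ m) ≡ boolToℕ (m <ᵇ n)
count-eq zero    m       = refl
count-eq (suc n) zero    = cong suc (∑-zero {n} (λ _ → refl))
count-eq (suc n) (suc m) = count-eq n m

B : ℕ → ℕ → ℕ
B k n = (k ∸ 1) * n ∸ k C 2

pascal₂ : ∀ m → suc m C 2 ≡ m + m C 2
pascal₂ m = trans (sym (nCk+nC[k+1]≡[n+1]C[k+1] m 1)) (cong (_+ m C 2) (nC1≡n m))

-- (k+1 choose 2) ≤ k n, so that the truncated subtraction in B is harmless.
C₂-bound : ∀ k n → suc k ≤ n → suc k C 2 ≤ k * n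
C₂-bound zero    n _ = z≤n
C₂-bound (suc k) n h = begin
  suc (suc k) C 2    ≡⟨ pascal₂ (suc k) ⟩
  suc k + suc k C 2  ≤⟨ +-mono-≤ (<⇒≤ h) (C₂-bound k n (<⇒≤ h)) ⟩
  n + k * n          ∎
  where open ≤-Reasoning

B-step : ∀ {k} n → 1 ≤ k → suc k ≤ n → B (suc k) n ≡ B k n + (n ∸ k)
B-step {suc k} n _ h = begin
  (n + k * n) ∸ suc (suc k) C 2           ≡⟨ cong ((n + k * n) ∸_) (pascal₂ (suc k)) ⟩
  (n + k * n) ∸ (suc k + suc k C 2)       ≡⟨ sym (∸-+-assoc (n + k * n) (suc k) _) ⟩
  (n + k * n) ∸ suc k ∸ suc k C 2         ≡⟨ cong (_∸ suc k C 2) (+-∸-comm (k * n) (<⇒≤ h)) ⟩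
  (n ∸ suc k) + k * n ∸ suc k C 2         ≡⟨ +-∸-assoc (n ∸ suc k) (C₂-bound k n (<⇒≤ h)) ⟩
  (n ∸ suc k) + (k * n ∸ suc k C 2)       ≡⟨ +-comm (n ∸ suc k) _ ⟩
  B (suc k) n + (n ∸ suc k)               ∎
  where open ≡-Reasoning

tree-pos : ∀ {k} → IncTree k → 1 ≤ k
tree-pos single       = s≤s z≤n
tree-pos (addRight _) = s≤s z≤n
tree-pos (addLeft _)  = s≤s z≤n

tree-longEdge : ∀ {k} (T : IncTree k) → treeGraph T zero (fromℕ k) ≡ true
tree-longEdge {k} T rewrite toℕ-fromℕ k = long T
  where
  long : ∀ {k} (T : IncTree k) → treeAdj T 0 k ≡ true
  long single             = refl
  long {suc k} (addRight T) rewrite ≡ᵇ-refl k = refl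
  long {suc k} (addLeft T)  = ≡ᵇ-refl k

addRight-inject₁ : ∀ {k} (T : IncTree k) (i j : Fin (suc k)) →
  treeGraph (addRight T) (inject₁ i) (inject₁ j) ≡ treeGraph T i j
addRight-inject₁ {k} T i j rewrite toℕ-inject₁ i | toℕ-inject₁ j
  with toℕ j ≡ᵇ suc k in eq
... | false = refl
... | true  = ⊥-elim (<⇒≢ (toℕ<n j) (≡ᵇ-sound eq))

addRight-fromℕ : ∀ {k} (T : IncTree k) (i : Fin (suc k)) →
  treeGraph (addRight T) (inject₁ i) (fromℕ (suc k)) ≡ (toℕ i ≡ᵇ 0)
addRight-fromℕ {k} T i rewrite toℕ-inject₁ i | toℕ-fromℕ k | ≡ᵇ-refl k = refl

Increasing : ∀ {m n} → (Fin m → Fin n) → Set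
Increasing f = ∀ i j → toℕ i < toℕ j → toℕ (f i) < toℕ (f j)

Preserves : ∀ {m n} → OrdGraph m → OrdGraph n → (Fin m → Fin n) → Set
Preserves F G f = ∀ i j → toℕ i < toℕ j → F i j ≡ true → G (f i) (f j) ≡ true

increasing-≤ : ∀ {m n} {f : Fin m → Fin n} → Increasing f →
  ∀ i j → toℕ i ≤ toℕ j → toℕ (f i) ≤ toℕ (f j)
increasing-≤ {f = f} inc i j i≤j with m≤n⇒m<n∨m≡n i≤j
... | inj₁ i<j = <⇒≤ (inc i j i<j)
... | inj₂ i≡j = ≤-reflexive (cong (toℕ ∘ f) (toℕ-injective i≡j))

stretch : ∀ {m n} (f : Fin (suc m) → Fin n) → Increasing f →
  ∀ i → toℕ (f zero) + toℕ i ≤ toℕ (f i)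
stretch f inc zero = ≤-reflexive (+-identityʳ _)
stretch {suc m} f inc (suc i) = begin
  toℕ (f zero) + suc (toℕ i)     ≡⟨ +-suc _ (toℕ i) ⟩
  suc (toℕ (f zero)) + toℕ i     ≤⟨ +-monoˡ-≤ (toℕ i) (inc zero (suc zero) z<s) ⟩
  toℕ (f (suc zero)) + toℕ i     ≤⟨ stretch (f ∘ suc) (λ a b a<b → inc (suc a) (suc b) (s≤s a<b)) i ⟩
  toℕ (f (suc i))                ∎
  where open ≤-Reasoning

band : ∀ {n} → ℕ → OrdGraph n
band k i j = toℕ j <ᵇ k + toℕ i

-- Any copy of T stretches 0—k to length ≥ k, which the band lacks.
band-free : ∀ {k n} (T : IncTree k) → ¬ Contains (treeGraph T) (band {n} k)
band-free {k} T (f , inc , pres) = <⇒≱ short long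
  where
  short : toℕ (f (fromℕ k)) < k + toℕ (f zero)
  short = <ᵇ-sound (pres zero (fromℕ k) (subst (0 <_) (sym (toℕ-fromℕ k)) (tree-pos T)) (tree-longEdge T))
  long : k + toℕ (f zero) ≤ toℕ (f (fromℕ k))
  long = subst (_≤ toℕ (f (fromℕ k))) (trans (cong (toℕ (f zero) +_) (toℕ-fromℕ k)) (+-comm _ k))
               (stretch f inc (fromℕ k))

<ᵇ-suc-split : ∀ a b → boolToℕ (a <ᵇ suc b) ≡ boolToℕ (a <ᵇ b) + boolToℕ (a ≡ᵇ b)
<ᵇ-suc-split zero    zero    = refl
<ᵇ-suc-split zero    (suc b) = refl
<ᵇ-suc-split (suc a) zero    = refl
<ᵇ-suc-split (suc a) (suc b) = <ᵇ-suc-split a b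

band₁-empty : ∀ a b → boolToℕ ((a <ᵇ b) ∧ (b <ᵇ suc a)) ≡ 0
band₁-empty zero    zero    = refl
band₁-empty zero    (suc b) = refl
band₁-empty (suc a) zero    = refl
band₁-empty (suc a) (suc b) = band₁-empty a b

band-widen : ∀ k a b →
  boolToℕ ((a <ᵇ b) ∧ (b <ᵇ suc (suc k) + a))
    ≡ boolToℕ ((a <ᵇ b) ∧ (b <ᵇ suc k + a)) + boolToℕ (b ≡ᵇ suc k + a)
band-widen k a b with a <ᵇ b in a<b?
... | true  = <ᵇ-suc-split b (suc k + a)
... | false with b ≡ᵇ suc k + a in b≡k+a
...   | false = refl
...   | true  = ⊥-elim (false≢true (trans (sym a<b?) (<ᵇ-complete a<b)))
  where
  a<b : a < b
  a<b = subst (a <_) (sym (≡ᵇ-sound b≡k+a)) (s≤s (m≤n+m a k))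
  false≢true : false ≢ true
  false≢true ()

band-edges : ∀ {n} k → 1 ≤ k → k ≤ n → edges (band {n} k) ≡ B k n
band-edges {n} 1 _ _ = ∑-zero {n} (λ i → ∑-zero {n} (λ j → band₁-empty (toℕ i) (toℕ j)))
band-edges {n} (suc (suc k)) _ h = begin
  edges (band {n} (suc (suc k)))
    ≡⟨ sum-cong-≗ {n} (λ i → trans (sum-cong-≗ {n} (λ j → band-widen k (toℕ i) (toℕ j))) (∑-distrib-+ {n} _ _)) ⟩
  ∑[ i < n ] (∑[ j < n ] boolToℕ (edge? (band (suc k)) i j) + ∑[ j < n ] distance i j)
    ≡⟨ ∑-distrib-+ {n} _ _ ⟩
  edges (band {n} (suc k)) + ∑[ i < n ] ∑[ j < n ] distance i j
    ≡⟨ cong₂ _+_ (band-edges (suc k) (s≤s z≤n) (<⇒≤ h)) (sum-cong-≗ {n} (λ i → count-eq n (suc k + toℕ i))) ⟩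
  B (suc k) n + ∑[ i < n ] boolToℕ (suc k + toℕ i <ᵇ n)
    ≡⟨ cong (B (suc k) n +_) (count-rows n (suc k)) ⟩
  B (suc k) n + (n ∸ suc k)
    ≡⟨ sym (B-step n (s≤s z≤n) h) ⟩
  B (suc (suc k)) n ∎
  where
  open ≡-Reasoning
  distance : Fin n → Fin n → ℕ
  distance i j = boolToℕ (toℕ j ≡ᵇ suc k + toℕ i)

data Hosts {n} (G : OrdGraph n) : ∀ {k} → IncTree k → Fin n → Fin n → Set where
  edge  : ∀ {u w} → Edge G u w → Hosts G single u w
  right : ∀ {k} {T : IncTree k} {u w x} →
          Hosts G T u w → toℕ w < toℕ x → Edge G u x → Hosts G (addRight T) u x
  left  : ∀ {k} {T : IncTree k} {y u w} →
          Hosts G T u w → toℕ y < toℕ u → Edge G y w → Hosts G (addLeft T) y w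

HostsFree : ∀ {k n} → OrdGraph n → IncTree k → Set
HostsFree G T = ∀ {u w} → ¬ Hosts G T u w

hosts-longEdge : ∀ {k n} {G : OrdGraph n} {T : IncTree k} {u w} → Hosts G T u w → Edge G u w
hosts-longEdge (edge e)      = e
hosts-longEdge (right _ _ e) = e
hosts-longEdge (left _ _ e)  = e

hosts-stretch : ∀ {k n} {G : OrdGraph n} {T : IncTree k} {u w} → Hosts G T u w → toℕ u + k ≤ toℕ w
hosts-stretch {u = u} {w} (edge e) = subst (_≤ toℕ w) (+-comm 1 (toℕ u)) (<ᵇ-sound (∧-trueˡ e))
hosts-stretch {suc k} {u = u} {x} (right h w<x _) =
  subst (_≤ toℕ x) (sym (+-suc (toℕ u) k)) (<-≤-trans (s≤s (hosts-stretch h)) w<x)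
hosts-stretch {suc k} {u = y} {w} (left h y<u _) =
  subst (_≤ toℕ w) (sym (+-suc (toℕ y) k)) (≤-trans (+-monoˡ-≤ k y<u) (hosts-stretch h))

_⊆_ : ∀ {n} → OrdGraph n → OrdGraph n → Set
G' ⊆ G = ∀ a b → G' a b ≡ true → G a b ≡ true

edge-mono : ∀ {n} {G' G : OrdGraph n} → G' ⊆ G → ∀ a b → Edge G' a b → Edge G a b
edge-mono {G' = G'} G'⊆G a b e = ∧-true (∧-trueˡ e) (G'⊆G a b (∧-trueʳ {toℕ a <ᵇ toℕ b} {G' a b} e))

hosts-mono : ∀ {k n} {G' G : OrdGraph n} {T : IncTree k} {u w} → G' ⊆ G → Hosts G' T u w → Hosts G T u w
hosts-mono G'⊆G (edge {u} {w} e)          = edge (edge-mono G'⊆G u w e)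
hosts-mono G'⊆G (right {u = u} {x = x} h w<x e) = right (hosts-mono G'⊆G h) w<x (edge-mono G'⊆G u x e)
hosts-mono G'⊆G (left {y = y} {w = w} h y<u e)  = left (hosts-mono G'⊆G h) y<u (edge-mono G'⊆G y w e)

record CopyAt {k n} (T : IncTree k) (G : OrdGraph n) (u w : Fin n) : Set where
  field
    embed      : Fin (suc k) → Fin n
    increasing : Increasing embed
    preserves  : Preserves (treeGraph T) G embed
    first      : embed zero ≡ u
    last       : embed (fromℕ k) ≡ w

copy-edge : ∀ {n} {G : OrdGraph n} {u w} → Edge G u w → CopyAt single G u w
copy-edge {G = G} {u} {w} e = record
  { embed = u ∷ w ∷ [] ; increasing = inc ; preserves = pres ; first = refl ; last = refl }
  where
  inc : Increasing (u ∷ w ∷ [])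
  inc zero       zero       ()
  inc zero       (suc zero) _ = <ᵇ-sound (∧-trueˡ e)
  inc (suc zero) zero       ()
  inc (suc zero) (suc zero) (s≤s ())
  pres : Preserves (treeGraph single) G (u ∷ w ∷ [])
  pres zero       zero       ()
  pres zero       (suc zero) _ _ = ∧-trueʳ e
  pres (suc zero) zero       ()
  pres (suc zero) (suc zero) (s≤s ())

snoc : ∀ {m} {A : Set} → (Fin (suc m) → A) → A → Fin (suc (suc m)) → A
snoc f x a with view a
... | ‵fromℕ         = x
... | ‵inj₁ {i = i} _ = f i

snoc-fromℕ : ∀ {m} {A : Set} (f : Fin (suc m) → A) x → snoc f x (fromℕ (suc m)) ≡ x
snoc-fromℕ {m} f x rewrite view-fromℕ (suc m) = refl

extendRight : ∀ {k n} {G : OrdGraph n} {T : IncTree k} {u w x} →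
  CopyAt T G u w → toℕ w < toℕ x → Edge G u x → CopyAt (addRight T) G u x
extendRight {k} {G = G} {T} {u} {w} {x} c w<x ux = record
  { embed = snoc f x ; increasing = inc ; preserves = pres ; first = first ; last = snoc-fromℕ f x }
  where
  open CopyAt c renaming (embed to f; increasing to f-inc; preserves to f-pres)
  inc : Increasing (snoc f x)
  inc a b a<b with view a | view b
  ... | ‵inj₁ {i = i} _ | ‵inj₁ {i = j} _ = f-inc i j (subst₂ _<_ (toℕ-inject₁ i) (toℕ-inject₁ j) a<b)
  ... | ‵inj₁ {i = i} _ | ‵fromℕ =
        ≤-<-trans (subst (toℕ (f i) ≤_) (cong toℕ last) (increasing-≤ f-inc i (fromℕ k) (≤fromℕ i))) w<x
  ... | ‵fromℕ | _ = ⊥-elim (<⇒≱ a<b (≤fromℕ b))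
  pres : Preserves (treeGraph (addRight T)) G (snoc f x)
  pres a b a<b e with view a | view b
  ... | ‵inj₁ {i = i} _ | ‵inj₁ {i = j} _ =
        f-pres i j (subst₂ _<_ (toℕ-inject₁ i) (toℕ-inject₁ j) a<b) (trans (sym (addRight-inject₁ T i j)) e)
  ... | ‵inj₁ {i = i} _ | ‵fromℕ =
        subst (λ v → G (f v) x ≡ true) (sym i≡0) (subst (λ v → G v x ≡ true) (sym first) (∧-trueʳ ux))
    where
    i≡0 : i ≡ zero
    i≡0 = toℕ-injective (≡ᵇ-sound (trans (sym (addRight-fromℕ T i)) e))
  ... | ‵fromℕ | _ = ⊥-elim (<⇒≱ a<b (≤fromℕ b))

extendLeft : ∀ {k n} {G : OrdGraph n} {T : IncTree k} {y u w} →
  CopyAt T G u w → toℕ y < toℕ u → Edge G y w → CopyAt (addLeft T) G y w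
extendLeft {k} {G = G} {T} {y} {u} {w} c y<u yw = record
  { embed = y ∷ f ; increasing = inc ; preserves = pres ; first = refl ; last = last }
  where
  open CopyAt c renaming (embed to f; increasing to f-inc; preserves to f-pres)
  inc : Increasing (y ∷ f)
  inc zero    zero    ()
  inc zero    (suc j) _ = <-≤-trans y<u (subst (_≤ toℕ (f j)) (cong toℕ first) (increasing-≤ f-inc zero j z≤n))
  inc (suc i) zero    ()
  inc (suc i) (suc j) (s≤s i<j) = f-inc i j i<j
  pres : Preserves (treeGraph (addLeft T)) G (y ∷ f)
  pres zero    zero    ()
  pres zero    (suc j) _ e = subst (λ v → G y (f v) ≡ true) (sym j≡k) (subst (λ v → G y v ≡ true) (sym last) (∧-trueʳ yw))
    where
    j≡k : j ≡ fromℕ k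
    j≡k = toℕ-injective (trans (≡ᵇ-sound e) (sym (toℕ-fromℕ k)))
  pres (suc i) zero    ()
  pres (suc i) (suc j) (s≤s i<j) e = f-pres i j i<j e

hosts⇒copy : ∀ {k n} {G : OrdGraph n} {T : IncTree k} {u w} → Hosts G T u w → CopyAt T G u w
hosts⇒copy (edge e)        = copy-edge e
hosts⇒copy (right h w<x e) = extendRight (hosts⇒copy h) w<x e
hosts⇒copy (left h y<u e)  = extendLeft (hosts⇒copy h) y<u e

free⇒hostsFree : ∀ {k n} {G : OrdGraph n} (T : IncTree k) → ¬ Contains (treeGraph T) G → HostsFree G T
free⇒hostsFree T free h = free (embed , increasing , preserves)
  where open CopyAt (hosts⇒copy h)

anyᵇ : ∀ {n} → (Fin n → Bool) → Bool
anyᵇ {zero}  _ = false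
anyᵇ {suc n} p = p zero ∨ anyᵇ (p ∘ suc)

laterᵇ : ∀ {n} → (Fin n → Bool) → Fin n → Bool
laterᵇ p zero    = anyᵇ (p ∘ suc)
laterᵇ p (suc j) = laterᵇ (p ∘ suc) j

earlierᵇ : ∀ {n} → (Fin n → Bool) → Fin n → Bool
earlierᵇ p zero    = false
earlierᵇ p (suc i) = p zero ∨ earlierᵇ (p ∘ suc) i

anyᵇ-sound : ∀ {n} (p : Fin n → Bool) → anyᵇ p ≡ true → ∃ λ j → p j ≡ true
anyᵇ-sound {suc n} p e with p zero in p₀
... | true  = zero , p₀
... | false with anyᵇ-sound (p ∘ suc) e
...   | j , pj = suc j , pj

anyᵇ-false : ∀ {n} (p : Fin n → Bool) → anyᵇ p ≡ false → ∑[ j < n ] boolToℕ (p j) ≡ 0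
anyᵇ-false {zero}  p e = refl
anyᵇ-false {suc n} p e with p zero
... | false = anyᵇ-false (p ∘ suc) e

laterᵇ-sound : ∀ {n} (p : Fin n → Bool) j → laterᵇ p j ≡ true →
  ∃ λ j' → toℕ j < toℕ j' × p j' ≡ true
laterᵇ-sound p zero e with anyᵇ-sound (p ∘ suc) e
... | j' , pj' = suc j' , z<s , pj'
laterᵇ-sound p (suc j) e with laterᵇ-sound (p ∘ suc) j e
... | j' , j<j' , pj' = suc j' , s≤s j<j' , pj'

earlierᵇ-sound : ∀ {n} (p : Fin n → Bool) i → earlierᵇ p i ≡ true →
  ∃ λ i' → toℕ i' < toℕ i × p i' ≡ true
earlierᵇ-sound p (suc i) e with p zero in p₀
... | true  = zero , z<s , p₀
... | false with earlierᵇ-sound (p ∘ suc) i e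
...   | i' , i'<i , pi' = suc i' , s≤s i'<i , pi'

-- Only the last true entry lacks a later one.
all-but-last : ∀ {n} (p : Fin n → Bool) →
  ∑[ j < n ] boolToℕ (p j) ≤ ∑[ j < n ] boolToℕ (p j ∧ laterᵇ p j) + 1
all-but-last {zero}  p = z≤n
all-but-last {suc n} p with anyᵇ (p ∘ suc) in rest
... | false rewrite anyᵇ-false (p ∘ suc) rest | ∧-zeroʳ (p zero) = lone (p zero)
  where
  -- no later entry is true, so p zero is the only one that can count
  lone : ∀ b → boolToℕ b + 0 ≤ 0 + ∑[ j < n ] boolToℕ (p (suc j) ∧ laterᵇ (p ∘ suc) j) + 1
  lone false = z≤n
  lone true  = m≤n+m 1 _
... | true rewrite ∧-identityʳ (p zero) =
  ≤-trans (+-monoʳ-≤ (boolToℕ (p zero)) (all-but-last (p ∘ suc)))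
          (≤-reflexive (sym (+-assoc (boolToℕ (p zero)) _ 1)))

-- Only the first true entry lacks an earlier one.
all-but-first : ∀ {n} (p : Fin n → Bool) →
  ∑[ i < n ] boolToℕ (p i) ≤ ∑[ i < n ] boolToℕ (p i ∧ earlierᵇ p i) + 1
all-but-first {zero}  p = z≤n
all-but-first {suc n} p with p zero
... | false = all-but-first (p ∘ suc)
... | true  = ≤-reflexive (trans (cong suc (sum-cong-≗ {n} (λ i → cong boolToℕ (sym (∧-identityʳ (p (suc i)))))))
                                 (+-comm 1 _))

guarded-drop : ∀ {n} (keep : (Fin n → Bool) → Fin n → Bool) →
  (∀ p → ∑[ j < n ] boolToℕ (p j) ≤ ∑[ j < n ] boolToℕ (p j ∧ keep p j) + 1) →
  ∀ c p → ∑[ j < n ] boolToℕ (p j) ≤ ∑[ j < n ] boolToℕ (p j ∧ (c ⇒ᵇ keep p j)) + boolToℕ c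
guarded-drop keep drop true  p = drop p
guarded-drop {n} keep drop false p = ≤-reflexive (sym (trans (+-identityʳ _)
  (sum-cong-≗ {n} (λ j → cong boolToℕ (∧-identityʳ (p j))))))

trimRows : ∀ {n} → ℕ → OrdGraph n → OrdGraph n
trimRows {n} k G i j = G i j ∧ ((k + toℕ i <ᵇ n) ⇒ᵇ laterᵇ (edge? G i) j)

trimCols : ∀ {n} → ℕ → OrdGraph n → OrdGraph n
trimCols k G i j = G i j ∧ ((k <ᵇ suc (toℕ j)) ⇒ᵇ earlierᵇ (λ i' → edge? G i' j) i)

-- Trimming removes at most one edge at each of the n ∸ k eligible vertices.
trimRows-loss : ∀ {n} k (G : OrdGraph n) → edges G ≤ edges (trimRows k G) + (n ∸ k)
trimRows-loss {n} k G =
  subst (edges G ≤_) (cong (edges (trimRows k G) +_) (count-rows n k))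
        (rowwise-≤ G (trimRows k G) room row)
  where
  room : Fin n → ℕ
  room i = boolToℕ (k + toℕ i <ᵇ n)
  row : ∀ i → ∑[ j < n ] boolToℕ (edge? G i j) ≤ ∑[ j < n ] boolToℕ (edge? (trimRows k G) i j) + room i
  row i = subst (λ s → _ ≤ s + room i)
                (sum-cong-≗ {n} (λ j → cong boolToℕ (∧-assoc (toℕ i <ᵇ toℕ j) (G i j) _)))
                (guarded-drop laterᵇ all-but-last (k + toℕ i <ᵇ n) (edge? G i))

trimCols-loss : ∀ {n} k (G : OrdGraph n) → edges G ≤ edges (trimCols k G) + (n ∸ k)
trimCols-loss {n} k G =
  subst (edges G ≤_) (cong (edges (trimCols k G) +_) (count-cols n k))
        (colwise-≤ G (trimCols k G) room col)
  where
  room : Fin n → ℕ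
  room j = boolToℕ (k <ᵇ suc (toℕ j))
  col : ∀ j → ∑[ i < n ] boolToℕ (edge? G i j) ≤ ∑[ i < n ] boolToℕ (edge? (trimCols k G) i j) + room j
  col j = subst (λ s → _ ≤ s + room j)
                (sum-cong-≗ {n} (λ i → cong boolToℕ (∧-assoc (toℕ i <ᵇ toℕ j) (G i j) _)))
                (guarded-drop earlierᵇ all-but-first (k <ᵇ suc (toℕ j)) (λ i → edge? G i j))

-- A copy of T in the trimmed graph, from u to w, has w ≥ u + k; so its
-- edge u—w was kept because of another edge of G that extends the copy.
trimRows-free : ∀ {k n} (T : IncTree k) (G : OrdGraph n) →
  HostsFree G (addRight T) → HostsFree (trimRows k G) T
trimRows-free {k} {n} T G free {u} {w} h =
  let (x , w<x , ux) = laterᵇ-sound (edge? G u) w (⇒ᵇ-mp room (∧-trueʳ {G u w} (∧-trueʳ {toℕ u <ᵇ toℕ w} (hosts-longEdge h))))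
  in free (right (hosts-mono (λ a b → ∧-trueˡ {G a b}) h) w<x ux)
  where
  room : (k + toℕ u <ᵇ n) ≡ true
  room = <ᵇ-complete (≤-<-trans (≤-trans (≤-reflexive (+-comm k (toℕ u))) (hosts-stretch h)) (toℕ<n w))

trimCols-free : ∀ {k n} (T : IncTree k) (G : OrdGraph n) →
  HostsFree G (addLeft T) → HostsFree (trimCols k G) T
trimCols-free {k} {n} T G free {u} {w} h =
  let (y , y<u , yw) = earlierᵇ-sound (λ i → edge? G i w) u (⇒ᵇ-mp room (∧-trueʳ {G u w} (∧-trueʳ {toℕ u <ᵇ toℕ w} (hosts-longEdge h))))
  in free (left (hosts-mono (λ a b → ∧-trueˡ {G a b}) h) y<u yw)
  where
  room : (k <ᵇ suc (toℕ w)) ≡ true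
  room = <ᵇ-complete (s≤s (≤-trans (m≤n+m k (toℕ u)) (hosts-stretch h)))

upper : ∀ {k} (T : IncTree k) {n} → suc k ≤ n → (G : OrdGraph n) → HostsFree G T → edges G ≤ B k n
upper single {n} _ G free = ≤-reflexive (∑-zero {n} (λ i → ∑-zero {n} (λ j → no-edge i j)))
  where
  no-edge : ∀ i j → boolToℕ (edge? G i j) ≡ 0
  no-edge i j with edge? G i j in e
  ... | false = refl
  ... | true  = ⊥-elim (free (edge e))
upper (addRight {k} T) {n} h G free = begin
  edges G                          ≤⟨ trimRows-loss k G ⟩
  edges (trimRows k G) + (n ∸ k)   ≤⟨ +-monoˡ-≤ (n ∸ k) (upper T (<⇒≤ h) (trimRows k G) (trimRows-free T G free)) ⟩
  B k n + (n ∸ k)                  ≡⟨ sym (B-step n (tree-pos T) (<⇒≤ h)) ⟩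
  B (suc k) n                      ∎
  where open ≤-Reasoning
upper (addLeft {k} T) {n} h G free = begin
  edges G                          ≤⟨ trimCols-loss k G ⟩
  edges (trimCols k G) + (n ∸ k)   ≤⟨ +-monoˡ-≤ (n ∸ k) (upper T (<⇒≤ h) (trimCols k G) (trimCols-free T G free)) ⟩
  B k n + (n ∸ k)                  ≡⟨ sym (B-step n (tree-pos T) (<⇒≤ h)) ⟩
  B (suc k) n                      ∎
  where open ≤-Reasoning

lemma2p2 : ∀ {k} (T : IncTree k) (n : ℕ) → suc k ≤ n →
    IsOrdEx n (treeGraph T) ((k ∸ 1) * n ∸ (k C 2))
lemma2p2 {k} T n h = (band k , band-free T , band-count) , upper-bound
  where
  band-count : edgeCount (band {n} k) ≡ B k n
  band-count = trans (edgeCount≡edges (band {n} k)) (band-edges k (tree-pos T) (<⇒≤ h))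
  upper-bound : ∀ G → ¬ Contains (treeGraph T) G → edgeCount G ≤ B k n
  upper-bound G G-free =
    subst (_≤ B k n) (sym (edgeCount≡edges G)) (upper T h G (free⇒hostsFree T G-free))
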